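{- Let $\mathcal{C}$ be a minor-closed class of matroids and $\mathcal{C}'_2$ the class of $2$-polymatroids whose natural matroids are in $\mathcal{C}$. Let $(E,\rho)$ be an excluded minor for $\mathcal{C}'_2$ and fix $e\in E$ with $\rho(\{e\})=2$. Then $\rho_{\downarrow e}$ is an excluded minor for $\mathcal{C}'_2$ if and only if $\rho_{\downarrow e}\notin\mathcal{C}'_2$.
   Context: A (integer) polymatroid is $(E,\rho)$ with $E$ finite, $\rho:2^E\to\mathbb{Z}$ normalized, nondecreasing and submodular; a $2$-polymatroid has $\rho(\{e\})\le 2$ for all $e$. Deletion $\rho_{\setminus X}$ is restriction to $E-X$; contraction $\rho_{/X}(Y)=\rho(Y\cup X)-\rho(X)$ on $E-X$; minors are $(\rho_{\setminus X})_{/Y}$ for disjoint $X,Y$. An excluded minor for a minor-closed class is a polymatroid not in the class whose proper minors all are. Natural matroid $M_\rho$: pairwise disjoint sets $X_e$ with $|X_e|=\rho(\{e\})$, $X_A=\bigcup_{e\in A}X_e$, rank $r(X)=\min\{\rho(A)+|X-X_A|:A\subseteq E\}$ on $X_E$. Compression: for $\rho(e)>0$, $\rho_{\downarrow e}$ is the polymatroid on $E-e$ with $\rho_{\downarrow e}(X)=\rho(X)-1$ if $\rho(X\cup e)=\rho(X)$ and $\rho_{\downarrow e}(X)=\rho(X)$ otherwise. -}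

module Defs where

open import Data.Nat using (ℕ; suc; _≤_; _∸_; _+_)
open import Data.Bool using (Bool; false)
open import Data.Fin using (Fin; _≟_)
open import Data.Fin.Properties using (any?)
open import Data.Fin.Subset using (Subset; _∪_; _∩_; _─_; ⁅_⁆; ⊤; ∁; ∣_∣; Nonempty; Empty; _∈_; outside)
open import Data.Fin.Subset.Properties using (_∈?_)
open import Data.Vec using (tabulate; lookup; insertAt)
open import Data.Product using (Σ; Σ-syntax; ∃; ∃-syntax; _×_)
open import Relation.Nullary using (¬_; does)
open import Relation.Nullary.Decidable using (_×-dec_)
open import Relation.Binary.PropositionalEquality using (_≡_)
open import Function.Definitions using (Injective)
open import Function.Bundles using (_⇔_)

-- A set function on the ground set E = Fin n.  Values are in ℕ: a normalized
-- nondecreasing function is automatically nonnegative.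
SetFn : ℕ → Set
SetFn n = Subset n → ℕ

record IsPolymatroid {n : ℕ} (ρ : SetFn n) : Set where
  field
    normalized : ρ Data.Fin.Subset.⊥ ≡ 0
    monotone   : ∀ X Y → X Data.Fin.Subset.⊆ Y → ρ X ≤ ρ Y
    submodular : ∀ X Y → ρ (X ∪ Y) + ρ (X ∩ Y) ≤ ρ X + ρ Y

Is2Polymatroid : {n : ℕ} → SetFn n → Set
Is2Polymatroid {n} ρ = IsPolymatroid ρ × (∀ (e : Fin n) → ρ ⁅ e ⁆ ≤ 2)

IsMatroid : {n : ℕ} → SetFn n → Set
IsMatroid {n} r = IsPolymatroid r × (∀ (e : Fin n) → r ⁅ e ⁆ ≤ 1)

image : {m n : ℕ} → (Fin m → Fin n) → Subset m → Subset n
image f Z = tabulate (λ j → does (any? (λ i → (f i ≟ j) ×-dec (i ∈? Z))))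

preimage : {N n : ℕ} → (Fin N → Fin n) → Subset n → Subset N
preimage π A = tabulate (λ x → lookup A (π x))

-- σ (on Fin m) is (isomorphic to) the minor (ρ \ X) / Y of ρ (on Fin n):
-- X, Y disjoint, f an injection of Fin m onto E - (X ∪ Y) identifying the
-- ground sets, and σ(Z) = ρ(f Z ∪ Y) - ρ(Y).
record MinorVia {m n : ℕ} (σ : SetFn m) (ρ : SetFn n) (X Y : Subset n) : Set where
  field
    disjoint : Empty (X ∩ Y)
    f        : Fin m → Fin n
    f-inj    : Injective _≡_ _≡_ f
    f-onto   : image f ⊤ ≡ ∁ (X ∪ Y)
    rank     : ∀ Z → σ Z ≡ ρ (image f Z ∪ Y) ∸ ρ Y

IsMinor : {m n : ℕ} → SetFn m → SetFn n → Set
IsMinor {m} {n} σ ρ = Σ[ X ∈ Subset n ] Σ[ Y ∈ Subset n ] MinorVia σ ρ X Y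

IsProperMinor : {m n : ℕ} → SetFn m → SetFn n → Set
IsProperMinor {m} {n} σ ρ =
  Σ[ X ∈ Subset n ] Σ[ Y ∈ Subset n ] (MinorVia σ ρ X Y × Nonempty (X ∪ Y))

Class : Set₁
Class = (n : ℕ) → SetFn n → Set

-- a minor-closed class of matroids (closure under minors includes closure
-- under isomorphism, since MinorVia allows relabelling the ground set)
record MinorClosedMatroidClass (C : Class) : Set where
  field
    matroids     : ∀ {n} (r : SetFn n) → C n r → IsMatroid r
    minor-closed : ∀ {m n} (σ : SetFn m) (r : SetFn n) → C n r → IsMinor σ r → C m σ

-- r (on X_E = Fin N) is a natural matroid of ρ (on E = Fin n): π assigns each
-- element of X_E the element e with it in X_e, |X_e| = ρ({e}), and
-- r(X) = min { ρ(A) + |X - X_A| : A ⊆ E }.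
record IsNaturalMatroid {n N : ℕ} (ρ : SetFn n) (r : SetFn N) : Set where
  field
    π          : Fin N → Fin n
    fibre-size : ∀ (e : Fin n) → ∣ preimage π ⁅ e ⁆ ∣ ≡ ρ ⁅ e ⁆
    rank-lower : ∀ (X : Subset N) (A : Subset n) → r X ≤ ρ A + ∣ X ─ preimage π A ∣
    rank-attained : ∀ (X : Subset N) → ∃[ A ] (r X ≡ ρ A + ∣ X ─ preimage π A ∣)

C'₂ : Class → Class
C'₂ C n ρ = Is2Polymatroid ρ × Σ[ N ∈ ℕ ] Σ[ r ∈ SetFn N ] (IsNaturalMatroid ρ r × C N r)

record ExcludedMinor (D : Class) {n : ℕ} (ρ : SetFn n) : Set₁ where
  field
    polymatroid  : IsPolymatroid ρ
    not-in-class : ¬ D n ρ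
    proper-minors-in : ∀ {m} (σ : SetFn m) → IsProperMinor σ ρ → D m σ

-- compression ρ↓e on E - e, where E = Fin (suc n) and E - e is identified
-- with Fin n via the embedding punchIn e (X ↦ insertAt X e outside).
compress : {n : ℕ} → SetFn (suc n) → Fin (suc n) → SetFn n
compress ρ e X with ρ (insertAt X e outside ∪ ⁅ e ⁆) Data.Nat.≟ ρ (insertAt X e outside)
... | Relation.Nullary.yes _ = ρ (insertAt X e outside) ∸ 1
... | Relation.Nullary.no _  = ρ (insertAt X e outside)

-- Only the backward direction has content: ρ↓e is a polymatroid, so it remains to see that
-- its proper minors lie in C′₂. If σ = (ρ↓e \ X) / Y is one of them and e ∈ cl(Y), then
-- contracting Y makes e a loop, so σ is also the proper minor (ρ \ (X ∪ e)) / Y of ρ.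
-- Otherwise σ is the compression at e of the proper minor ρ′ = (ρ \ X) / Y, and C′₂ is
-- closed under compression at an element e of positive rank: in the natural matroid of
-- ρ′, contract one element of X_e, delete the rest of X_e and one element of X_f for each
-- f with e ∈ cl({f}); what remains is a natural matroid of ρ′↓e, and it lies in C since C
-- is minor-closed. The hypothesis ρ({e}) = 2 is used only through ρ({e}) ≥ 1.

module Submission where

open import Data.Bool using (Bool; true; not; _∧_; _∨_)
open import Data.Bool.Properties using (∨-identityʳ)
open import Data.Empty using (⊥-elim)
open import Data.Fin as Fin using (Fin; zero; suc; punchIn; punchOut)
open import Data.Fin.Properties using (any?; suc-injective; punchIn-injective; punchInᵢ≢i; punchIn-punchOut)
open import Data.Fin.Subset
open import Data.Fin.Subset.Properties
open import Data.Nat as ℕ using (ℕ; zero; suc; _+_; _∸_; _≤_; _<_; z≤n; s≤s)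
open import Data.Nat.Properties as ℕₚ using (≤-refl; ≤-trans; ≤-antisym; ≤-reflexive; +-mono-≤; +-suc; +-comm; m≤m+n; m≤n+m)
open import Data.Product using (∃; _×_; _,_; proj₁; proj₂)
open import Data.Sum using (_⊎_; inj₁; inj₂; [_,_]′)
open import Data.Vec using (_∷_; []; tabulate; lookup; insertAt; tail; here; there)
open import Data.Vec.Properties using ([]=⇒lookup; lookup⇒[]=; lookup∘tabulate; insertAt-lookup; insertAt-punchIn)
open import Function.Base using (_∘_; case_of_)
open import Function.Bundles using (_⇔_; mk⇔)
open import Function.Definitions using (Injective)
open import Relation.Nullary using (¬_; Dec; yes; no; does)
open import Relation.Nullary.Decidable using (dec-true; _×-dec_)
open import Relation.Binary.PropositionalEquality

open import Defs

private
  variable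
    m n N : ℕ

m<n⇒m≤n∸1 : ∀ {m n} → m < n → m ≤ n ∸ 1
m<n⇒m≤n∸1 (s≤s m≤n) = m≤n

m∸1<m : ∀ {m} → 1 ≤ m → m ∸ 1 < m
m∸1<m {suc m} _ = ℕₚ.n<1+n m

m+n≤o+p⇒[m∸1]+n≤[o∸1]+p : ∀ {m n o p} → 1 ≤ m → 1 ≤ o → m + n ≤ o + p → m ∸ 1 + n ≤ o ∸ 1 + p
m+n≤o+p⇒[m∸1]+n≤[o∸1]+p {suc m} {o = suc o} _ _ (s≤s h) = h

m+n≤o+p⇒[m∸1]+[n∸1]≤[o∸1]+[p∸1] : ∀ {m n o p} → 1 ≤ m → 1 ≤ n → 1 ≤ o → 1 ≤ p →
                                   m + n ≤ o + p → m ∸ 1 + (n ∸ 1) ≤ o ∸ 1 + (p ∸ 1)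
m+n≤o+p⇒[m∸1]+[n∸1]≤[o∸1]+[p∸1] {suc m} {suc n} {suc o} {suc p} _ _ _ _ (s≤s h) =
  ℕ.s≤s⁻¹ (subst₂ _≤_ (+-suc m n) (+-suc o p) h)

m+n<o+p⇒[m∸1]+n≤[o∸1]+[p∸1] : ∀ {m n o p} → 1 ≤ m → 1 ≤ o → 1 ≤ p →
                               m + n < o + p → m ∸ 1 + n ≤ o ∸ 1 + (p ∸ 1)
m+n<o+p⇒[m∸1]+n≤[o∸1]+[p∸1] {suc m} {n} {suc o} {suc p} _ _ _ (s≤s h) =
  ℕ.s≤s⁻¹ (subst (suc (m + n) ≤_) (+-suc o p) h)

m≤n+o⇒m∸1≤[n∸1]+o : ∀ m n o → m ≤ n + o → m ∸ 1 ≤ n ∸ 1 + o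
m≤n+o⇒m∸1≤[n∸1]+o zero n o _ = z≤n
m≤n+o⇒m∸1≤[n∸1]+o (suc m) zero o m<o = ≤-trans (ℕₚ.n≤1+n m) m<o
m≤n+o⇒m∸1≤[n∸1]+o (suc m) (suc n) o (s≤s m≤n+o) = m≤n+o

[m∸1]∸[n∸1]≡m∸n : ∀ m n → 1 ≤ n → m ∸ 1 ∸ (n ∸ 1) ≡ m ∸ n
[m∸1]∸[n∸1]≡m∸n m (suc n) _ = ℕₚ.∸-+-assoc m 1 n

[m∸1]∸n≡[m∸n]∸1 : ∀ m n → m ∸ 1 ∸ n ≡ m ∸ n ∸ 1
[m∸1]∸n≡[m∸n]∸1 m n = trans (ℕₚ.∸-+-assoc m 1 n) (trans (cong (m ∸_) (+-comm 1 n)) (sym (ℕₚ.∸-+-assoc m n 1)))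

∪-least : ∀ {p q r : Subset n} → p ⊆ r → q ⊆ r → p ∪ q ⊆ r
∪-least {p = p} {q} p⊆r q⊆r x∈ = [ p⊆r , q⊆r ]′ (x∈p∪q⁻ p q x∈)

∩-greatest : ∀ {p q r : Subset n} → r ⊆ p → r ⊆ q → r ⊆ p ∩ q
∩-greatest r⊆p r⊆q x∈ = x∈p∩q⁺ (r⊆p x∈ , r⊆q x∈)

x∈p─q⇒x∉q : ∀ (p q : Subset n) {x} → x ∈ p ─ q → x ∉ q
x∈p─q⇒x∉q (s ∷ p) (inside ∷ q) {zero} ()
x∈p─q⇒x∉q (inside ∷ p) (outside ∷ q) {zero} here ()
x∈p─q⇒x∉q (s ∷ p) (t ∷ q) {suc x} (there x∈) x∈q = x∈p─q⇒x∉q p q x∈ (drop-there x∈q)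

x∈p⇒⁅x⁆⊆p : ∀ {x : Fin n} {p : Subset n} → x ∈ p → ⁅ x ⁆ ⊆ p
x∈p⇒⁅x⁆⊆p {x = x} x∈p y∈ rewrite x∈⁅y⁆⇒x≡y x y∈ = x∈p

∈-tabulate⁻ : ∀ {f : Fin n → Bool} {x} → x ∈ tabulate f → f x ≡ true
∈-tabulate⁻ {f = f} {x} x∈ = trans (sym (lookup∘tabulate f x)) ([]=⇒lookup x∈)

∈-tabulate⁺ : ∀ {f : Fin n → Bool} {x} → f x ≡ true → x ∈ tabulate f
∈-tabulate⁺ {f = f} {x} fx = lookup⇒[]= x _ (trans (lookup∘tabulate f x) fx)

1≤∣p∣⇒Nonempty : ∀ (p : Subset n) → 1 ≤ ∣ p ∣ → Nonempty p
1≤∣p∣⇒Nonempty {n} p 1≤∣p∣ with nonempty? p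
... | yes p≢∅ = p≢∅
... | no p≡∅ with () ← subst (1 ≤_) (trans (cong ∣_∣ (Empty-unique p≡∅)) (∣⊥∣≡0 n)) 1≤∣p∣

∣p∪q∣+∣p∩q∣≡∣p∣+∣q∣ : ∀ (p q : Subset n) → ∣ p ∪ q ∣ + ∣ p ∩ q ∣ ≡ ∣ p ∣ + ∣ q ∣
∣p∪q∣+∣p∩q∣≡∣p∣+∣q∣ [] [] = refl
∣p∪q∣+∣p∩q∣≡∣p∣+∣q∣ (inside ∷ p) (inside ∷ q) =
  cong suc (trans (+-suc ∣ p ∪ q ∣ ∣ p ∩ q ∣)
                  (trans (cong suc (∣p∪q∣+∣p∩q∣≡∣p∣+∣q∣ p q)) (sym (+-suc ∣ p ∣ ∣ q ∣))))
∣p∪q∣+∣p∩q∣≡∣p∣+∣q∣ (inside ∷ p) (outside ∷ q) = cong suc (∣p∪q∣+∣p∩q∣≡∣p∣+∣q∣ p q)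
∣p∪q∣+∣p∩q∣≡∣p∣+∣q∣ (outside ∷ p) (inside ∷ q) =
  trans (cong suc (∣p∪q∣+∣p∩q∣≡∣p∣+∣q∣ p q)) (sym (+-suc ∣ p ∣ ∣ q ∣))
∣p∪q∣+∣p∩q∣≡∣p∣+∣q∣ (outside ∷ p) (outside ∷ q) = ∣p∪q∣+∣p∩q∣≡∣p∣+∣q∣ p q

∣p∪q∣≤∣p∣+∣q∣ : ∀ (p q : Subset n) → ∣ p ∪ q ∣ ≤ ∣ p ∣ + ∣ q ∣
∣p∪q∣≤∣p∣+∣q∣ p q = ≤-trans (m≤m+n _ _) (≤-reflexive (∣p∪q∣+∣p∩q∣≡∣p∣+∣q∣ p q))

firstElement : Subset N → Subset N
firstElement [] = []
firstElement (inside ∷ p) = inside ∷ ⊥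
firstElement (outside ∷ p) = outside ∷ firstElement p

∣p─firstElement∣≡∣p∣∸1 : ∀ (p : Subset N) → 1 ≤ ∣ p ∣ → ∣ p ─ firstElement p ∣ ≡ ∣ p ∣ ∸ 1
∣p─firstElement∣≡∣p∣∸1 (inside ∷ p) _ = cong ∣_∣ (p─⊥≡p p)
∣p─firstElement∣≡∣p∣∸1 (outside ∷ p) 1≤∣p∣ = ∣p─firstElement∣≡∣p∣∸1 p 1≤∣p∣

module _ (f : Fin m → Fin n) {Z : Subset m} where

  ∈-image⁻ : ∀ {j} → j ∈ image f Z → ∃ λ i → f i ≡ j × i ∈ Z
  ∈-image⁻ {j} j∈ = witness (any? (λ i → (f i Fin.≟ j) ×-dec (i ∈? Z))) (∈-tabulate⁻ j∈)
    where
    witness : ∀ {A : Set} (a? : Dec A) → does a? ≡ true → A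
    witness (yes a) _ = a

  ∈-image⁺ : ∀ {i j} → f i ≡ j → i ∈ Z → j ∈ image f Z
  ∈-image⁺ {i} fi≡j i∈Z = ∈-tabulate⁺ (dec-true (any? _) (i , fi≡j , i∈Z))

image-⊥ : ∀ (f : Fin m → Fin n) → image f ⊥ ≡ ⊥
image-⊥ f = Empty-unique (λ (j , j∈) → ∉⊥ (proj₂ (proj₂ (∈-image⁻ f j∈))))

∈-preimage⁻ : ∀ (π : Fin N → Fin n) {A x} → x ∈ preimage π A → π x ∈ A
∈-preimage⁻ π {A} x∈ = lookup⇒[]= (π _) A (∈-tabulate⁻ x∈)

∈-preimage⁺ : ∀ (π : Fin N → Fin n) {A x} → π x ∈ A → x ∈ preimage π A
∈-preimage⁺ π πx∈ = ∈-tabulate⁺ ([]=⇒lookup πx∈)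

enumerate : ∀ (K : Subset N) → Fin ∣ K ∣ → Fin N
enumerate (inside ∷ K) zero = zero
enumerate (inside ∷ K) (suc i) = suc (enumerate K i)
enumerate (outside ∷ K) i = suc (enumerate K i)

enumerate-∈ : ∀ (K : Subset N) i → enumerate K i ∈ K
enumerate-∈ (inside ∷ K) zero = here
enumerate-∈ (inside ∷ K) (suc i) = there (enumerate-∈ K i)
enumerate-∈ (outside ∷ K) i = there (enumerate-∈ K i)

enumerate-onto : ∀ (K : Subset N) {x} → x ∈ K → ∃ λ i → enumerate K i ≡ x
enumerate-onto (inside ∷ K) {zero} here = zero , refl
enumerate-onto (inside ∷ K) {suc x} (there x∈K) =
  let i , eq = enumerate-onto K x∈K in suc i , cong suc eq
enumerate-onto (outside ∷ K) {suc x} (there x∈K) =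
  let i , eq = enumerate-onto K x∈K in i , cong suc eq

enumerate-injective : ∀ (K : Subset N) → Injective _≡_ _≡_ (enumerate K)
enumerate-injective (inside ∷ K) {zero} {zero} _ = refl
enumerate-injective (inside ∷ K) {suc i} {suc j} eq = cong suc (enumerate-injective K (suc-injective eq))
enumerate-injective (outside ∷ K) eq = enumerate-injective K (suc-injective eq)

∣image-enumerate∣ : ∀ (K : Subset N) (Z : Subset ∣ K ∣) → ∣ image (enumerate K) Z ∣ ≡ ∣ Z ∣
∣image-enumerate∣ K Z = trans (cong ∣_∣ (⊆-antisym image⊆spread spread⊆image)) (∣spread∣ K Z)
  where
  spread : ∀ {N} (K : Subset N) → Subset ∣ K ∣ → Subset N
  spread [] Z = []
  spread (inside ∷ K) (z ∷ Z) = z ∷ spread K Z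
  spread (outside ∷ K) Z = outside ∷ spread K Z

  ∣spread∣ : ∀ {N} (K : Subset N) Z → ∣ spread K Z ∣ ≡ ∣ Z ∣
  ∣spread∣ [] [] = refl
  ∣spread∣ (inside ∷ K) (inside ∷ Z) = cong suc (∣spread∣ K Z)
  ∣spread∣ (inside ∷ K) (outside ∷ Z) = ∣spread∣ K Z
  ∣spread∣ (outside ∷ K) Z = ∣spread∣ K Z

  ∈-spread⁺ : ∀ {N} (K : Subset N) Z {i} → i ∈ Z → enumerate K i ∈ spread K Z
  ∈-spread⁺ (inside ∷ K) (inside ∷ Z) {zero} here = here
  ∈-spread⁺ (inside ∷ K) (z ∷ Z) {suc i} (there i∈Z) = there (∈-spread⁺ K Z i∈Z)
  ∈-spread⁺ (outside ∷ K) Z i∈Z = there (∈-spread⁺ K Z i∈Z)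

  ∈-spread⁻ : ∀ {N} (K : Subset N) Z {x} → x ∈ spread K Z → ∃ λ i → enumerate K i ≡ x × i ∈ Z
  ∈-spread⁻ (inside ∷ K) (inside ∷ Z) {zero} here = zero , refl , here
  ∈-spread⁻ (inside ∷ K) (z ∷ Z) {suc x} (there x∈) =
    let i , eq , i∈Z = ∈-spread⁻ K Z x∈ in suc i , cong suc eq , there i∈Z
  ∈-spread⁻ (outside ∷ K) Z {suc x} (there x∈) =
    let i , eq , i∈Z = ∈-spread⁻ K Z x∈ in i , cong suc eq , i∈Z

  image⊆spread : image (enumerate K) Z ⊆ spread K Z
  image⊆spread x∈ with ∈-image⁻ (enumerate K) x∈
  ... | i , refl , i∈Z = ∈-spread⁺ K Z i∈Z

  spread⊆image : spread K Z ⊆ image (enumerate K) Z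
  spread⊆image x∈ = let i , eq , i∈Z = ∈-spread⁻ K Z x∈ in ∈-image⁺ (enumerate K) eq i∈Z

image-suc-outside : ∀ (g : Fin (suc m) → Fin n) Z → image g (outside ∷ Z) ≡ image (g ∘ suc) Z
image-suc-outside g Z = ⊆-antisym sub sup
  where
  sub : image g (outside ∷ Z) ⊆ image (g ∘ suc) Z
  sub x∈ with ∈-image⁻ g x∈
  ... | suc i , refl , there i∈Z = ∈-image⁺ (g ∘ suc) refl i∈Z
  sup : image (g ∘ suc) Z ⊆ image g (outside ∷ Z)
  sup x∈ with ∈-image⁻ (g ∘ suc) x∈
  ... | i , refl , i∈Z = ∈-image⁺ g refl (there i∈Z)

image-suc-inside : ∀ (g : Fin (suc m) → Fin n) Z → image g (inside ∷ Z) ≡ image (g ∘ suc) Z ∪ ⁅ g zero ⁆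
image-suc-inside g Z = ⊆-antisym sub sup
  where
  sub : image g (inside ∷ Z) ⊆ image (g ∘ suc) Z ∪ ⁅ g zero ⁆
  sub x∈ with ∈-image⁻ g x∈
  ... | zero , refl , _ = q⊆p∪q _ _ (x∈⁅x⁆ (g zero))
  ... | suc i , refl , there i∈Z = p⊆p∪q _ (∈-image⁺ (g ∘ suc) refl i∈Z)
  sup : image (g ∘ suc) Z ∪ ⁅ g zero ⁆ ⊆ image g (inside ∷ Z)
  sup x∈ with x∈p∪q⁻ (image (g ∘ suc) Z) _ x∈
  ... | inj₂ x∈⁅g0⁆ = ∈-image⁺ g (sym (x∈⁅y⁆⇒x≡y _ x∈⁅g0⁆)) here
  ... | inj₁ x∈gZ with ∈-image⁻ (g ∘ suc) x∈gZ
  ... | i , refl , i∈Z = ∈-image⁺ g refl (there i∈Z)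

module _ (f : Fin m → Fin n) {P : Subset m} {Q : Subset n}
         (Q⇒P : ∀ {i} → f i ∈ Q → i ∈ P) (P⇒Q : ∀ {i} → i ∈ P → f i ∈ Q) where

  image-∩ : ∀ Z → image f (Z ∩ P) ≡ image f Z ∩ Q
  image-∩ Z = ⊆-antisym sub sup
    where
    sub : image f (Z ∩ P) ⊆ image f Z ∩ Q
    sub x∈ with ∈-image⁻ f x∈
    ... | i , refl , i∈Z∩P = let i∈Z , i∈P = x∈p∩q⁻ Z P i∈Z∩P in x∈p∩q⁺ (∈-image⁺ f refl i∈Z , P⇒Q i∈P)
    sup : image f Z ∩ Q ⊆ image f (Z ∩ P)
    sup x∈ with x∈p∩q⁻ (image f Z) Q x∈
    ... | x∈fZ , x∈Q with ∈-image⁻ f x∈fZ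
    ... | i , refl , i∈Z = ∈-image⁺ f refl (x∈p∩q⁺ (i∈Z , Q⇒P x∈Q))

  image-─ : ∀ Z → image f (Z ─ P) ≡ image f Z ─ Q
  image-─ Z = ⊆-antisym sub sup
    where
    sub : image f (Z ─ P) ⊆ image f Z ─ Q
    sub x∈ with ∈-image⁻ f x∈
    ... | i , refl , i∈Z─P =
      x∈p∧x∉q⇒x∈p─q (∈-image⁺ f refl (p─q⊆p Z P i∈Z─P)) (x∈p─q⇒x∉q Z P i∈Z─P ∘ Q⇒P)
    sup : image f Z ─ Q ⊆ image f (Z ─ P)
    sup x∈ with ∈-image⁻ f (p─q⊆p (image f Z) Q x∈)
    ... | i , refl , i∈Z = ∈-image⁺ f refl (x∈p∧x∉q⇒x∈p─q i∈Z (x∈p─q⇒x∉q (image f Z) Q x∈ ∘ P⇒Q))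

image-enumerate-⊤ : ∀ (K : Subset N) → image (enumerate K) ⊤ ≡ K
image-enumerate-⊤ K = ⊆-antisym sub sup
  where
  sub : image (enumerate K) ⊤ ⊆ K
  sub x∈ with ∈-image⁻ (enumerate K) x∈
  ... | i , refl , _ = enumerate-∈ K i
  sup : K ⊆ image (enumerate K) ⊤
  sup x∈K = let i , eq = enumerate-onto K x∈K in ∈-image⁺ (enumerate K) eq ∈⊤

fibre : (Fin N → Fin n) → Fin n → Subset N
fibre π f = preimage π ⁅ f ⁆

∈-fibre⁻ : ∀ (π : Fin N → Fin n) {f x} → x ∈ fibre π f → π x ≡ f
∈-fibre⁻ π {f} x∈ = x∈⁅y⁆⇒x≡y f (∈-preimage⁻ π x∈)

∈-fibre⁺ : ∀ (π : Fin N → Fin n) {f x} → π x ≡ f → x ∈ fibre π f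
∈-fibre⁺ π refl = ∈-preimage⁺ π (x∈⁅x⁆ _)

liftAt : Fin (suc n) → Subset n → Subset (suc n)
liftAt e X = insertAt X e outside

module _ (e : Fin (suc n)) where

  e∉liftAt : ∀ X → e ∉ liftAt e X
  e∉liftAt X e∈ with () ← trans (sym (insertAt-lookup X e outside)) ([]=⇒lookup e∈)

  punchIn∈liftAt⁺ : ∀ {X i} → i ∈ X → punchIn e i ∈ liftAt e X
  punchIn∈liftAt⁺ {X} {i} i∈X = lookup⇒[]= _ _ (trans (insertAt-punchIn X e outside i) ([]=⇒lookup i∈X))

  punchIn∈liftAt⁻ : ∀ {X i} → punchIn e i ∈ liftAt e X → i ∈ X
  punchIn∈liftAt⁻ {X} {i} ∈L = lookup⇒[]= i X (trans (sym (insertAt-punchIn X e outside i)) ([]=⇒lookup ∈L))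

  ∈-liftAt⁻ : ∀ {X x} → x ∈ liftAt e X → ∃ λ i → punchIn e i ≡ x × i ∈ X
  ∈-liftAt⁻ {X} {x} x∈ with e Fin.≟ x
  ... | yes refl = ⊥-elim (e∉liftAt X x∈)
  ... | no e≢x = punchOut e≢x , punchIn-punchOut e≢x ,
                 punchIn∈liftAt⁻ (subst (_∈ liftAt e X) (sym (punchIn-punchOut e≢x)) x∈)

  liftAt-⊆ : ∀ {X Y} → X ⊆ Y → liftAt e X ⊆ liftAt e Y
  liftAt-⊆ X⊆Y x∈ with ∈-liftAt⁻ x∈
  ... | i , refl , i∈X = punchIn∈liftAt⁺ (X⊆Y i∈X)

  liftAt-disjoint : ∀ {X Y} → Empty (X ∩ Y) → ∀ {x} → x ∈ liftAt e X → x ∉ liftAt e Y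
  liftAt-disjoint X∩Y≡∅ x∈X x∈Y with ∈-liftAt⁻ x∈X | ∈-liftAt⁻ x∈Y
  ... | i , refl , i∈X | j , eq , j∈Y with refl ← punchIn-injective e j i eq =
    X∩Y≡∅ (i , x∈p∩q⁺ (i∈X , j∈Y))

liftAt-⊥ : ∀ (e : Fin (suc n)) → liftAt e (⊥ {n}) ≡ ⊥
liftAt-⊥ zero = refl
liftAt-⊥ {suc n} (suc e) = cong (outside ∷_) (liftAt-⊥ e)

liftAt-∪ : ∀ (e : Fin (suc n)) X Y → liftAt e (X ∪ Y) ≡ liftAt e X ∪ liftAt e Y
liftAt-∪ zero X Y = refl
liftAt-∪ (suc e) (x ∷ X) (y ∷ Y) = cong ((x ∨ y) ∷_) (liftAt-∪ e X Y)

liftAt-∩ : ∀ (e : Fin (suc n)) X Y → liftAt e (X ∩ Y) ≡ liftAt e X ∩ liftAt e Y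
liftAt-∩ zero X Y = refl
liftAt-∩ (suc e) (x ∷ X) (y ∷ Y) = cong ((x ∧ y) ∷_) (liftAt-∩ e X Y)

liftAt-∁ : ∀ (e : Fin (suc n)) X → liftAt e (∁ X) ≡ ∁ (liftAt e X ∪ ⁅ e ⁆)
liftAt-∁ zero X = cong (outside ∷_) (cong ∁ (sym (∪-identityʳ X)))
liftAt-∁ {suc n} (suc e) (x ∷ X) = cong₂ _∷_ (cong not (sym (∨-identityʳ x))) (liftAt-∁ e X)

liftAt-∁-∪⁅e⁆ : ∀ (e : Fin (suc n)) X → liftAt e (∁ X) ∪ ⁅ e ⁆ ≡ ∁ (liftAt e X)
liftAt-∁-∪⁅e⁆ zero X = cong (inside ∷_) (∪-identityʳ (∁ X))
liftAt-∁-∪⁅e⁆ {suc n} (suc e) (x ∷ X) = cong₂ _∷_ (∨-identityʳ (not x)) (liftAt-∁-∪⁅e⁆ e X)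

image-punchIn∘ : ∀ (e : Fin (suc n)) (f : Fin m → Fin n) Z → image (punchIn e ∘ f) Z ≡ liftAt e (image f Z)
image-punchIn∘ e f Z = ⊆-antisym sub sup
  where
  sub : image (punchIn e ∘ f) Z ⊆ liftAt e (image f Z)
  sub x∈ with ∈-image⁻ (punchIn e ∘ f) x∈
  ... | i , refl , i∈Z = punchIn∈liftAt⁺ e (∈-image⁺ f refl i∈Z)
  sup : liftAt e (image f Z) ⊆ image (punchIn e ∘ f) Z
  sup x∈ with ∈-liftAt⁻ e x∈
  ... | j , refl , j∈ with ∈-image⁻ f j∈
  ... | i , refl , i∈Z = ∈-image⁺ (punchIn e ∘ f) refl i∈Z

-- Compression

Spans : SetFn (suc n) → Fin (suc n) → Subset (suc n) → Set
Spans ρ e W = ρ (W ∪ ⁅ e ⁆) ≡ ρ W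

-- The compression extended to all subsets of E; compress ρ e is its restriction to E - e.
lowerAt : SetFn (suc n) → Fin (suc n) → SetFn (suc n)
lowerAt ρ e W with ρ (W ∪ ⁅ e ⁆) ℕₚ.≟ ρ W
... | yes _ = ρ W ∸ 1
... | no _ = ρ W

lowerAt-view : ∀ (ρ : SetFn (suc n)) e W →
  (Spans ρ e W × lowerAt ρ e W ≡ ρ W ∸ 1) ⊎ (¬ Spans ρ e W × lowerAt ρ e W ≡ ρ W)
lowerAt-view ρ e W with ρ (W ∪ ⁅ e ⁆) ℕₚ.≟ ρ W
... | yes spans = inj₁ (spans , refl)
... | no ¬spans = inj₂ (¬spans , refl)

compress-view : ∀ (ρ : SetFn (suc n)) e X →
  (Spans ρ e (liftAt e X) × compress ρ e X ≡ ρ (liftAt e X) ∸ 1) ⊎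
  (¬ Spans ρ e (liftAt e X) × compress ρ e X ≡ ρ (liftAt e X))
compress-view ρ e X with ρ (liftAt e X ∪ ⁅ e ⁆) ℕₚ.≟ ρ (liftAt e X)
... | yes spans = inj₁ (spans , refl)
... | no ¬spans = inj₂ (¬spans , refl)

compress≡lowerAt∘liftAt : ∀ (ρ : SetFn (suc n)) e X → compress ρ e X ≡ lowerAt ρ e (liftAt e X)
compress≡lowerAt∘liftAt ρ e X with ρ (liftAt e X ∪ ⁅ e ⁆) ℕₚ.≟ ρ (liftAt e X)
... | yes _ = refl
... | no _ = refl

IsPolymatroid-resp-≗ : ∀ {σ τ : SetFn n} → (∀ Z → σ Z ≡ τ Z) → IsPolymatroid τ → IsPolymatroid σ
IsPolymatroid-resp-≗ {σ = σ} σ≗τ isP = record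
  { normalized = trans (σ≗τ ⊥) normalized
  ; monotone = λ X Y X⊆Y → subst₂ _≤_ (sym (σ≗τ X)) (sym (σ≗τ Y)) (monotone X Y X⊆Y)
  ; submodular = λ X Y → subst₂ _≤_ (sym (cong₂ _+_ (σ≗τ (X ∪ Y)) (σ≗τ (X ∩ Y))))
                                    (sym (cong₂ _+_ (σ≗τ X) (σ≗τ Y))) (submodular X Y)
  }
  where open IsPolymatroid isP

IsPolymatroid-∘liftAt : ∀ {ρ : SetFn (suc n)} e → IsPolymatroid ρ → IsPolymatroid (λ X → ρ (liftAt e X))
IsPolymatroid-∘liftAt {ρ = ρ} e isP = record
  { normalized = trans (cong ρ (liftAt-⊥ e)) normalized
  ; monotone = λ X Y X⊆Y → monotone _ _ (liftAt-⊆ e X⊆Y)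
  ; submodular = λ X Y → subst₂ (λ U I → ρ U + ρ I ≤ ρ (liftAt e X) + ρ (liftAt e Y))
                                 (sym (liftAt-∪ e X Y)) (sym (liftAt-∩ e X Y))
                                 (submodular (liftAt e X) (liftAt e Y))
  }
  where open IsPolymatroid isP

module Compression {ρ : SetFn (suc n)} (isP : IsPolymatroid ρ) (e : Fin (suc n)) (1≤ρe : 1 ≤ ρ ⁅ e ⁆) where
  open IsPolymatroid isP

  mono : ∀ {X Y} → X ⊆ Y → ρ X ≤ ρ Y
  mono = monotone _ _

  Spans-mono : ∀ {X Y} → X ⊆ Y → Spans ρ e X → Spans ρ e Y
  Spans-mono {X} {Y} X⊆Y X-spans = ≤-antisym ρ[Y∪e]≤ρY (mono (p⊆p∪q _))
    where
    ρ[Y∪e]≤ρY : ρ (Y ∪ ⁅ e ⁆) ≤ ρ Y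
    ρ[Y∪e]≤ρY = ℕₚ.+-cancelʳ-≤ (ρ X) _ _ (begin
      ρ (Y ∪ ⁅ e ⁆) + ρ X                  ≤⟨ +-mono-≤ (mono (∪-least (p⊆p∪q _) (λ x∈ → q⊆p∪q Y _ (q⊆p∪q X _ x∈))))
                                                        (mono (∩-greatest X⊆Y (p⊆p∪q _))) ⟩
      ρ (Y ∪ (X ∪ ⁅ e ⁆)) + ρ (Y ∩ (X ∪ ⁅ e ⁆)) ≤⟨ submodular Y (X ∪ ⁅ e ⁆) ⟩
      ρ Y + ρ (X ∪ ⁅ e ⁆)                  ≡⟨ cong (ρ Y +_) X-spans ⟩
      ρ Y + ρ X                            ∎)
      where open ℕₚ.≤-Reasoning

  ¬Spans⇒< : ∀ {X} → ¬ Spans ρ e X → ρ X < ρ (X ∪ ⁅ e ⁆)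
  ¬Spans⇒< ¬spans = ℕₚ.≤∧≢⇒< (mono (p⊆p∪q _)) (λ eq → ¬spans (sym eq))

  Spans⇒1≤ : ∀ {X} → Spans ρ e X → 1 ≤ ρ X
  Spans⇒1≤ {X} spans = ≤-trans 1≤ρe (≤-trans (mono (q⊆p∪q X _)) (≤-reflexive spans))

  -- the one place where the submodularity of lowerAt needs more than that of ρ
  spans-both⇒submodular-strict : ∀ {X Y} → Spans ρ e X → Spans ρ e Y → ¬ Spans ρ e (X ∩ Y) →
                                 ρ (X ∪ Y) + ρ (X ∩ Y) < ρ X + ρ Y
  spans-both⇒submodular-strict {X} {Y} X-spans Y-spans ¬∩-spans = begin-strict
    ρ (X ∪ Y) + ρ (X ∩ Y)                                  <⟨ ℕₚ.+-monoʳ-< (ρ (X ∪ Y)) (¬Spans⇒< ¬∩-spans) ⟩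
    ρ (X ∪ Y) + ρ ((X ∩ Y) ∪ ⁅ e ⁆)                         ≤⟨ +-mono-≤ (mono ∪⊆) (mono ∩∪e⊆) ⟩
    ρ ((X ∪ ⁅ e ⁆) ∪ (Y ∪ ⁅ e ⁆)) + ρ ((X ∪ ⁅ e ⁆) ∩ (Y ∪ ⁅ e ⁆)) ≤⟨ submodular (X ∪ ⁅ e ⁆) (Y ∪ ⁅ e ⁆) ⟩
    ρ (X ∪ ⁅ e ⁆) + ρ (Y ∪ ⁅ e ⁆)                           ≡⟨ cong₂ _+_ X-spans Y-spans ⟩
    ρ X + ρ Y                                              ∎
    where
    open ℕₚ.≤-Reasoning
    ∪⊆ : X ∪ Y ⊆ (X ∪ ⁅ e ⁆) ∪ (Y ∪ ⁅ e ⁆)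
    ∪⊆ = ∪-least (λ x∈ → p⊆p∪q _ (p⊆p∪q _ x∈)) (λ x∈ → q⊆p∪q _ _ (p⊆p∪q _ x∈))
    ∩∪e⊆ : (X ∩ Y) ∪ ⁅ e ⁆ ⊆ (X ∪ ⁅ e ⁆) ∩ (Y ∪ ⁅ e ⁆)
    ∩∪e⊆ = ∪-least (∩-greatest (λ x∈ → p⊆p∪q _ (p∩q⊆p X Y x∈)) (λ x∈ → p⊆p∪q _ (p∩q⊆q X Y x∈)))
                   (∩-greatest (q⊆p∪q X _) (q⊆p∪q Y _))

  lowerAt≤ : ∀ W → lowerAt ρ e W ≤ ρ W
  lowerAt≤ W with lowerAt-view ρ e W
  ... | inj₁ (_ , eq) = ≤-trans (≤-reflexive eq) (ℕₚ.m∸n≤m _ 1)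
  ... | inj₂ (_ , eq) = ≤-reflexive eq

  lowerAt-isPolymatroid : IsPolymatroid (lowerAt ρ e)
  lowerAt-isPolymatroid = record
    { normalized = lowerAt-normalized
    ; monotone = λ X Y → lowerAt-monotone
    ; submodular = lowerAt-submodular
    }
    where
    lowerAt-normalized : lowerAt ρ e ⊥ ≡ 0
    lowerAt-normalized with lowerAt-view ρ e ⊥
    ... | inj₁ (_ , eq) = trans eq (cong (_∸ 1) normalized)
    ... | inj₂ (_ , eq) = trans eq normalized

    lowerAt-monotone : ∀ {X Y} → X ⊆ Y → lowerAt ρ e X ≤ lowerAt ρ e Y
    lowerAt-monotone {X} {Y} X⊆Y with lowerAt-view ρ e X | lowerAt-view ρ e Y
    ... | inj₁ (_ , eqX) | inj₁ (_ , eqY) rewrite eqX | eqY = ℕₚ.∸-monoˡ-≤ 1 (mono X⊆Y)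
    ... | inj₁ (X-spans , _) | inj₂ (¬Y-spans , _) = ⊥-elim (¬Y-spans (Spans-mono X⊆Y X-spans))
    ... | inj₂ (¬X-spans , eqX) | inj₁ (Y-spans , eqY) rewrite eqX | eqY =
      m<n⇒m≤n∸1 (ℕₚ.<-≤-trans (¬Spans⇒< ¬X-spans)
        (≤-trans (mono (∪-least (λ x∈ → p⊆p∪q _ (X⊆Y x∈)) (q⊆p∪q Y _))) (≤-reflexive Y-spans)))
    ... | inj₂ (_ , eqX) | inj₂ (_ , eqY) rewrite eqX | eqY = mono X⊆Y

    lowerAt-submodular : ∀ X Y → lowerAt ρ e (X ∪ Y) + lowerAt ρ e (X ∩ Y) ≤ lowerAt ρ e X + lowerAt ρ e Y
    lowerAt-submodular X Y
      with lowerAt-view ρ e (X ∪ Y) | lowerAt-view ρ e (X ∩ Y) | lowerAt-view ρ e X | lowerAt-view ρ e Y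
    ... | inj₂ (¬∪ , _) | _ | inj₁ (X-spans , _) | _ = ⊥-elim (¬∪ (Spans-mono (p⊆p∪q Y) X-spans))
    ... | inj₂ (¬∪ , _) | _ | _ | inj₁ (Y-spans , _) = ⊥-elim (¬∪ (Spans-mono (q⊆p∪q X Y) Y-spans))
    ... | _ | inj₁ (∩-spans , _) | inj₂ (¬X , _) | _ = ⊥-elim (¬X (Spans-mono (p∩q⊆p X Y) ∩-spans))
    ... | _ | inj₁ (∩-spans , _) | _ | inj₂ (¬Y , _) = ⊥-elim (¬Y (Spans-mono (p∩q⊆q X Y) ∩-spans))
    ... | inj₁ (∪s , eq∪) | inj₁ (∩s , eq∩) | inj₁ (Xs , eqX) | inj₁ (Ys , eqY) rewrite eq∪ | eq∩ | eqX | eqY =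
      m+n≤o+p⇒[m∸1]+[n∸1]≤[o∸1]+[p∸1] (Spans⇒1≤ ∪s) (Spans⇒1≤ ∩s) (Spans⇒1≤ Xs) (Spans⇒1≤ Ys) (submodular X Y)
    ... | inj₁ (∪s , eq∪) | inj₂ (¬∩s , eq∩) | inj₁ (Xs , eqX) | inj₁ (Ys , eqY) rewrite eq∪ | eq∩ | eqX | eqY =
      m+n<o+p⇒[m∸1]+n≤[o∸1]+[p∸1] (Spans⇒1≤ ∪s) (Spans⇒1≤ Xs) (Spans⇒1≤ Ys)
        (spans-both⇒submodular-strict Xs Ys ¬∩s)
    ... | inj₁ (∪s , eq∪) | inj₂ (_ , eq∩) | inj₁ (Xs , eqX) | inj₂ (_ , eqY) rewrite eq∪ | eq∩ | eqX | eqY =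
      m+n≤o+p⇒[m∸1]+n≤[o∸1]+p (Spans⇒1≤ ∪s) (Spans⇒1≤ Xs) (submodular X Y)
    ... | inj₁ (∪s , eq∪) | inj₂ (_ , eq∩) | inj₂ (_ , eqX) | inj₁ (Ys , eqY) rewrite eq∪ | eq∩ | eqX | eqY =
      subst (ρ (X ∪ Y) ∸ 1 + ρ (X ∩ Y) ≤_) (+-comm (ρ Y ∸ 1) (ρ X))
        (m+n≤o+p⇒[m∸1]+n≤[o∸1]+p (Spans⇒1≤ ∪s) (Spans⇒1≤ Ys)
          (subst (ρ (X ∪ Y) + ρ (X ∩ Y) ≤_) (+-comm (ρ X) (ρ Y)) (submodular X Y)))
    ... | _ | inj₂ (_ , eq∩) | inj₂ (_ , eqX) | inj₂ (_ , eqY) rewrite eq∩ | eqX | eqY =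
      ≤-trans (+-mono-≤ (lowerAt≤ (X ∪ Y)) ≤-refl) (submodular X Y)

  compress-isPolymatroid : IsPolymatroid (compress ρ e)
  compress-isPolymatroid =
    IsPolymatroid-resp-≗ (compress≡lowerAt∘liftAt ρ e) (IsPolymatroid-∘liftAt e lowerAt-isPolymatroid)

  compress≤ρ∘liftAt : ∀ X → compress ρ e X ≤ ρ (liftAt e X)
  compress≤ρ∘liftAt X = ≤-trans (≤-reflexive (compress≡lowerAt∘liftAt ρ e X)) (lowerAt≤ (liftAt e X))

  compress<ρ[liftAt∪e] : ∀ A → compress ρ e A < ρ (liftAt e A ∪ ⁅ e ⁆)
  compress<ρ[liftAt∪e] A with compress-view ρ e A
  ... | inj₁ (spans , eq) = subst (_< ρ (liftAt e A ∪ ⁅ e ⁆)) (sym eq)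
          (ℕₚ.<-≤-trans (m∸1<m (Spans⇒1≤ spans)) (≤-reflexive (sym spans)))
  ... | inj₂ (¬spans , eq) = subst (_< ρ (liftAt e A ∪ ⁅ e ⁆)) (sym eq) (¬Spans⇒< ¬spans)

-- The natural matroid of a compression

module _ {ρ : SetFn n} (isP : IsPolymatroid ρ) {r : SetFn N} (nat : IsNaturalMatroid ρ r) where
  open IsPolymatroid isP
  open IsNaturalMatroid nat

  natural-rank-⁅⁆ : ∀ x → 1 ≤ ρ ⁅ π x ⁆ → r ⁅ x ⁆ ≡ 1
  natural-rank-⁅⁆ x 1≤ρπx = ≤-antisym r⁅x⁆≤1 1≤r⁅x⁆
    where
    r⁅x⁆≤1 : r ⁅ x ⁆ ≤ 1
    r⁅x⁆≤1 = begin
      r ⁅ x ⁆                                ≤⟨ rank-lower ⁅ x ⁆ ⊥ ⟩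
      ρ ⊥ + ∣ ⁅ x ⁆ ─ preimage π ⊥ ∣          ≤⟨ +-mono-≤ (≤-reflexive normalized) (∣p─q∣≤∣p∣ ⁅ x ⁆ _) ⟩
      ∣ ⁅ x ⁆ ∣                              ≡⟨ ∣⁅x⁆∣≡1 x ⟩
      1                                      ∎
      where open ℕₚ.≤-Reasoning
    1≤r⁅x⁆ : 1 ≤ r ⁅ x ⁆
    1≤r⁅x⁆ with rank-attained ⁅ x ⁆
    ... | B , eq with π x ∈? B
    ...   | yes πx∈B = subst (1 ≤_) (sym eq) (≤-trans (≤-trans 1≤ρπx (monotone _ _ (x∈p⇒⁅x⁆⊆p πx∈B))) (m≤m+n _ _))
    ...   | no πx∉B = subst (1 ≤_) (sym eq) (≤-trans (≤-trans (≤-reflexive (sym (∣⁅x⁆∣≡1 x)))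
                        (p⊆q⇒∣p∣≤∣q∣ ⁅x⁆⊆)) (m≤n+m _ _))
      where
      ⁅x⁆⊆ : ⁅ x ⁆ ⊆ ⁅ x ⁆ ─ preimage π B
      ⁅x⁆⊆ y∈ rewrite x∈⁅y⁆⇒x≡y x y∈ = x∈p∧x∉q⇒x∈p─q (x∈⁅x⁆ x) (πx∉B ∘ ∈-preimage⁻ π)

-- Contract an element a of X_0, delete the rest of X_0 and, for every f with 0 ∈ cl({f}),
-- one element of X_f: the result is a natural matroid of compress ρ zero.
module NaturalMatroidOfCompression {ρ : SetFn (suc m)} (isP : IsPolymatroid ρ) (1≤ρ0 : 1 ≤ ρ ⁅ zero ⁆)
                                   {r : SetFn N} (nat : IsNaturalMatroid ρ r) where
  open IsNaturalMatroid nat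
  open Compression isP zero 1≤ρ0

  X₀-nonempty : Nonempty (fibre π zero)
  X₀-nonempty = 1≤∣p∣⇒Nonempty (fibre π zero) (subst (1 ≤_) (sym (fibre-size zero)) 1≤ρ0)

  a : Fin N
  a = proj₁ X₀-nonempty

  πa≡0 : π a ≡ zero
  πa≡0 = ∈-fibre⁻ π (proj₂ X₀-nonempty)

  kept : Fin (suc m) → Subset N
  kept zero = ⊥
  kept (suc f) with compress-view ρ zero ⁅ f ⁆
  ... | inj₁ _ = fibre π (suc f) ─ firstElement (fibre π (suc f))
  ... | inj₂ _ = fibre π (suc f)

  kept⊆fibre : ∀ f → kept f ⊆ fibre π f
  kept⊆fibre zero = ⊥⊆
  kept⊆fibre (suc f) with compress-view ρ zero ⁅ f ⁆
  ... | inj₁ _ = p─q⊆p _ _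
  ... | inj₂ _ = λ x∈ → x∈

  ∣kept∣ : ∀ f → ∣ kept (suc f) ∣ ≡ compress ρ zero ⁅ f ⁆
  ∣kept∣ f with compress-view ρ zero ⁅ f ⁆
  ... | inj₁ (spans , eq) = begin
    ∣ fibre π (suc f) ─ firstElement (fibre π (suc f)) ∣ ≡⟨ ∣p─firstElement∣≡∣p∣∸1 (fibre π (suc f)) 1≤∣X∣ ⟩
    ∣ fibre π (suc f) ∣ ∸ 1                            ≡⟨ cong (_∸ 1) (fibre-size (suc f)) ⟩
    ρ ⁅ suc f ⁆ ∸ 1                                   ≡⟨ sym eq ⟩
    compress ρ zero ⁅ f ⁆                             ∎
    where
    open ≡-Reasoning
    1≤∣X∣ : 1 ≤ ∣ fibre π (suc f) ∣
    1≤∣X∣ = subst (1 ≤_) (sym (fibre-size (suc f))) (Spans⇒1≤ spans)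
  ... | inj₂ (_ , eq) = trans (fibre-size (suc f)) (sym eq)

  K : Subset N
  K = tabulate (λ x → lookup (kept (π x)) x)

  ∈K⇒∈kept : ∀ {x} → x ∈ K → x ∈ kept (π x)
  ∈K⇒∈kept x∈ = lookup⇒[]= _ _ (∈-tabulate⁻ x∈)

  ∈kept⇒∈K : ∀ {x} → x ∈ kept (π x) → x ∈ K
  ∈kept⇒∈K x∈ = ∈-tabulate⁺ ([]=⇒lookup x∈)

  ∈K⇒π≢0 : ∀ {x} → x ∈ K → zero ≢ π x
  ∈K⇒π≢0 {x} x∈K 0≡πx = ∉⊥ (subst (λ f → x ∈ kept f) (sym 0≡πx) (∈K⇒∈kept x∈K))

  a∉K : a ∉ K
  a∉K a∈K = ∈K⇒π≢0 a∈K (sym πa≡0)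

  K∩fibre : ∀ f → K ∩ fibre π (suc f) ≡ kept (suc f)
  K∩fibre f = ⊆-antisym sub sup
    where
    sub : K ∩ fibre π (suc f) ⊆ kept (suc f)
    sub {x} x∈ = let x∈K , x∈X = x∈p∩q⁻ K _ x∈ in
      subst (λ g → x ∈ kept g) (∈-fibre⁻ π {suc f} x∈X) (∈K⇒∈kept x∈K)
    sup : kept (suc f) ⊆ K ∩ fibre π (suc f)
    sup {x} x∈ = let x∈X = kept⊆fibre (suc f) x∈ in
      x∈p∩q⁺ (∈kept⇒∈K (subst (λ g → x ∈ kept g) (sym (∈-fibre⁻ π {suc f} x∈X)) x∈) , x∈X)

  N′ : ℕ
  N′ = ∣ K ∣

  emb : Fin N′ → Fin N
  emb = enumerate K

  π′ : Fin N′ → Fin m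
  π′ i = punchOut (∈K⇒π≢0 (enumerate-∈ K i))

  π∘emb : ∀ i → π (emb i) ≡ suc (π′ i)
  π∘emb i = sym (punchIn-punchOut (∈K⇒π≢0 (enumerate-∈ K i)))

  r′ : SetFn N′
  r′ Z = r (image emb Z ∪ ⁅ a ⁆) ∸ r ⁅ a ⁆

  W : Subset N′ → Subset N
  W = image emb

  W⊆K : ∀ Z → W Z ⊆ K
  W⊆K Z x∈ with ∈-image⁻ emb x∈
  ... | i , refl , _ = enumerate-∈ K i

  fibre-size′ : ∀ f → ∣ fibre π′ f ∣ ≡ compress ρ zero ⁅ f ⁆
  fibre-size′ f = begin
    ∣ fibre π′ f ∣                       ≡⟨ sym (∣image-enumerate∣ K _) ⟩
    ∣ W (fibre π′ f) ∣                   ≡⟨ cong (∣_∣ ∘ W) (sym (∩-identityˡ _)) ⟩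
    ∣ W (⊤ ∩ fibre π′ f) ∣               ≡⟨ cong ∣_∣ (image-∩ emb emb∈⇒ ⇒emb∈ ⊤) ⟩
    ∣ W ⊤ ∩ fibre π (suc f) ∣            ≡⟨ cong (λ p → ∣ p ∩ fibre π (suc f) ∣) (image-enumerate-⊤ K) ⟩
    ∣ K ∩ fibre π (suc f) ∣              ≡⟨ cong ∣_∣ (K∩fibre f) ⟩
    ∣ kept (suc f) ∣                     ≡⟨ ∣kept∣ f ⟩
    compress ρ zero ⁅ f ⁆                ∎
    where
    open ≡-Reasoning
    emb∈⇒ : ∀ {i} → emb i ∈ fibre π (suc f) → i ∈ fibre π′ f
    emb∈⇒ {i} x∈ = ∈-fibre⁺ π′ (suc-injective (trans (sym (π∘emb i)) (∈-fibre⁻ π x∈)))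
    ⇒emb∈ : ∀ {i} → i ∈ fibre π′ f → emb i ∈ fibre π (suc f)
    ⇒emb∈ {i} i∈ = ∈-fibre⁺ π (trans (π∘emb i) (cong suc (∈-fibre⁻ π′ i∈)))

  ∣Z─π′⁻¹A∣ : ∀ Z A → ∣ Z ─ preimage π′ A ∣ ≡ ∣ W Z ─ preimage π (liftAt zero A) ∣
  ∣Z─π′⁻¹A∣ Z A = trans (sym (∣image-enumerate∣ K _)) (cong ∣_∣ (image-─ emb emb∈⇒ ⇒emb∈ Z))
    where
    emb∈⇒ : ∀ {i} → emb i ∈ preimage π (liftAt zero A) → i ∈ preimage π′ A
    emb∈⇒ {i} x∈ = ∈-preimage⁺ π′ (drop-there (subst (_∈ liftAt zero A) (π∘emb i) (∈-preimage⁻ π x∈)))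
    ⇒emb∈ : ∀ {i} → i ∈ preimage π′ A → emb i ∈ preimage π (liftAt zero A)
    ⇒emb∈ {i} i∈ = ∈-preimage⁺ π (subst (_∈ liftAt zero A) (sym (π∘emb i)) (there (∈-preimage⁻ π′ i∈)))

  r′≡ : ∀ Z → r′ Z ≡ r (W Z ∪ ⁅ a ⁆) ∸ 1
  r′≡ Z = cong (r (W Z ∪ ⁅ a ⁆) ∸_) (natural-rank-⁅⁆ isP nat a (subst (λ f → 1 ≤ ρ ⁅ f ⁆) (sym πa≡0) 1≤ρ0))

  a∉W : ∀ Z → a ∉ W Z
  a∉W Z = a∉K ∘ W⊆K Z

  rank-lower′ : ∀ Z A → r′ Z ≤ compress ρ zero A + ∣ Z ─ preimage π′ A ∣
  rank-lower′ Z A = subst₂ _≤_ (sym (r′≡ Z)) (cong (compress ρ zero A +_) (sym (∣Z─π′⁻¹A∣ Z A)))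
                           (bound (compress-view ρ zero A))
    where
    A₀ = liftAt zero A
    D = W Z ─ preimage π A₀
    open ℕₚ.≤-Reasoning

    bound : (Spans ρ zero A₀ × compress ρ zero A ≡ ρ A₀ ∸ 1) ⊎ (¬ Spans ρ zero A₀ × compress ρ zero A ≡ ρ A₀) →
            r (W Z ∪ ⁅ a ⁆) ∸ 1 ≤ compress ρ zero A + ∣ D ∣
    bound (inj₁ (spans , eq)) = subst (λ c → r (W Z ∪ ⁅ a ⁆) ∸ 1 ≤ c + ∣ D ∣) (sym eq)
      (m≤n+o⇒m∸1≤[n∸1]+o _ (ρ A₀) ∣ D ∣ (begin
        r (W Z ∪ ⁅ a ⁆)
          ≤⟨ rank-lower _ (A₀ ∪ ⁅ zero ⁆) ⟩
        ρ (A₀ ∪ ⁅ zero ⁆) + ∣ (W Z ∪ ⁅ a ⁆) ─ preimage π (A₀ ∪ ⁅ zero ⁆) ∣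
          ≤⟨ +-mono-≤ (≤-reflexive spans) (p⊆q⇒∣p∣≤∣q∣ sub) ⟩
        ρ A₀ + ∣ D ∣
          ∎))
      where
      sub : (W Z ∪ ⁅ a ⁆) ─ preimage π (A₀ ∪ ⁅ zero ⁆) ⊆ D
      sub y∈ with x∈p∪q⁻ (W Z) ⁅ a ⁆ (p─q⊆p _ _ y∈)
      ... | inj₁ y∈W = x∈p∧x∉q⇒x∈p─q y∈W
                         (x∈p─q⇒x∉q _ _ y∈ ∘ ∈-preimage⁺ π ∘ p⊆p∪q {p = A₀} ⁅ zero ⁆ ∘ ∈-preimage⁻ π)
      ... | inj₂ y∈⁅a⁆ with refl ← x∈⁅y⁆⇒x≡y a y∈⁅a⁆ = ⊥-elim (x∈p─q⇒x∉q _ _ y∈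
                         (∈-preimage⁺ π (subst (_∈ A₀ ∪ ⁅ zero ⁆) (sym πa≡0) (q⊆p∪q A₀ _ (x∈⁅x⁆ zero)))))
    bound (inj₂ (_ , eq)) = subst (λ c → r (W Z ∪ ⁅ a ⁆) ∸ 1 ≤ c + ∣ D ∣) (sym eq)
      (ℕₚ.m≤n+o⇒m∸n≤o _ 1 (begin
        r (W Z ∪ ⁅ a ⁆)                          ≤⟨ rank-lower _ A₀ ⟩
        ρ A₀ + ∣ (W Z ∪ ⁅ a ⁆) ─ preimage π A₀ ∣ ≤⟨ +-mono-≤ (≤-refl {ρ A₀}) (p⊆q⇒∣p∣≤∣q∣ sub) ⟩
        ρ A₀ + ∣ D ∪ ⁅ a ⁆ ∣                     ≤⟨ +-mono-≤ (≤-refl {ρ A₀}) (∣p∪q∣≤∣p∣+∣q∣ D ⁅ a ⁆) ⟩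
        ρ A₀ + (∣ D ∣ + ∣ ⁅ a ⁆ ∣)               ≡⟨ cong (λ k → ρ A₀ + (∣ D ∣ + k)) (∣⁅x⁆∣≡1 a) ⟩
        ρ A₀ + (∣ D ∣ + 1)                       ≡⟨ trans (cong (ρ A₀ +_) (+-comm ∣ D ∣ 1)) (+-suc (ρ A₀) ∣ D ∣) ⟩
        1 + (ρ A₀ + ∣ D ∣)                       ∎))
      where
      sub : (W Z ∪ ⁅ a ⁆) ─ preimage π A₀ ⊆ D ∪ ⁅ a ⁆
      sub y∈ with x∈p∪q⁻ (W Z) ⁅ a ⁆ (p─q⊆p _ _ y∈)
      ... | inj₁ y∈W = p⊆p∪q ⁅ a ⁆ (x∈p∧x∉q⇒x∈p─q y∈W (x∈p─q⇒x∉q _ _ y∈))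
      ... | inj₂ y∈⁅a⁆ = q⊆p∪q D _ y∈⁅a⁆

  rank-attained-bound : ∀ Z B → compress ρ zero (tail B) + ∣ W Z ─ preimage π (liftAt zero (tail B)) ∣
                                < ρ B + ∣ (W Z ∪ ⁅ a ⁆) ─ preimage π B ∣
  rank-attained-bound Z (inside ∷ A) = ℕₚ.+-mono-<-≤
    (subst (compress ρ zero A <_) (cong (λ p → ρ (inside ∷ p)) (∪-identityʳ A)) (compress<ρ[liftAt∪e] A))
    (p⊆q⇒∣p∣≤∣q∣ sub)
    where
    sub : W Z ─ preimage π (outside ∷ A) ⊆ (W Z ∪ ⁅ a ⁆) ─ preimage π (inside ∷ A)
    sub y∈ with ∈-image⁻ emb (p─q⊆p _ _ y∈)
    ... | i , refl , _ = x∈p∧x∉q⇒x∈p─q (p⊆p∪q ⁅ a ⁆ (p─q⊆p _ _ y∈)) λ y∈πA →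
      x∈p─q⇒x∉q _ _ y∈ (∈-preimage⁺ π (subst (_∈ outside ∷ A) (sym (π∘emb i))
        (there (drop-there (subst (_∈ inside ∷ A) (π∘emb i) (∈-preimage⁻ π y∈πA))))))
  rank-attained-bound Z (outside ∷ A) = ℕₚ.+-mono-≤-< (compress≤ρ∘liftAt A) (p⊂q⇒∣p∣<∣q∣ (sub , a , a∈ , a∉))
    where
    sub : W Z ─ preimage π (outside ∷ A) ⊆ (W Z ∪ ⁅ a ⁆) ─ preimage π (outside ∷ A)
    sub y∈ = x∈p∧x∉q⇒x∈p─q (p⊆p∪q ⁅ a ⁆ (p─q⊆p _ _ y∈)) (x∈p─q⇒x∉q _ _ y∈)
    a∈ : a ∈ (W Z ∪ ⁅ a ⁆) ─ preimage π (outside ∷ A)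
    a∈ = x∈p∧x∉q⇒x∈p─q (q⊆p∪q (W Z) _ (x∈⁅x⁆ a))
           (λ a∈A₀ → case subst (_∈ outside ∷ A) πa≡0 (∈-preimage⁻ π a∈A₀) of λ ())
    a∉ : a ∉ W Z ─ preimage π (outside ∷ A)
    a∉ = a∉W Z ∘ p─q⊆p _ _

  rank-attained′ : ∀ Z → ∃ λ A → r′ Z ≡ compress ρ zero A + ∣ Z ─ preimage π′ A ∣
  rank-attained′ Z with rank-attained (W Z ∪ ⁅ a ⁆)
  ... | B , eq = tail B , ≤-antisym (rank-lower′ Z (tail B))
    (subst₂ _≤_ (cong (compress ρ zero (tail B) +_) (sym (∣Z─π′⁻¹A∣ Z (tail B)))) (sym (r′≡ Z))
      (m<n⇒m≤n∸1 (subst (compress ρ zero (tail B) + ∣ W Z ─ preimage π (liftAt zero (tail B)) ∣ <_)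
                        (sym eq) (rank-attained-bound Z B))))

  natural′ : IsNaturalMatroid (compress ρ zero) r′
  natural′ = record
    { π = π′
    ; fibre-size = fibre-size′
    ; rank-lower = rank-lower′
    ; rank-attained = rank-attained′
    }

  r′-minor : IsMinor r′ r
  r′-minor = ∁ (K ∪ ⁅ a ⁆) , ⁅ a ⁆ , record
    { disjoint = disjoint
    ; f = emb
    ; f-inj = enumerate-injective K
    ; f-onto = trans (image-enumerate-⊤ K) (⊆-antisym sub sup)
    ; rank = λ Z → refl
    }
    where
    disjoint : Empty (∁ (K ∪ ⁅ a ⁆) ∩ ⁅ a ⁆)
    disjoint (y , y∈) with x∈p∩q⁻ (∁ (K ∪ ⁅ a ⁆)) ⁅ a ⁆ y∈
    ... | y∈∁ , y∈⁅a⁆ = x∈∁p⇒x∉p y∈∁ (q⊆p∪q K _ y∈⁅a⁆)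
    sub : K ⊆ ∁ (∁ (K ∪ ⁅ a ⁆) ∪ ⁅ a ⁆)
    sub {y} y∈K = x∉p⇒x∈∁p λ y∈ → [ (λ y∈∁ → x∈∁p⇒x∉p y∈∁ (p⊆p∪q _ y∈K))
                                  , (λ y∈⁅a⁆ → a∉K (subst (_∈ K) (x∈⁅y⁆⇒x≡y a y∈⁅a⁆) y∈K)) ]′ (x∈p∪q⁻ _ _ y∈)
    sup : ∁ (∁ (K ∪ ⁅ a ⁆) ∪ ⁅ a ⁆) ⊆ K
    sup y∈ with x∈p∪q⁻ K ⁅ a ⁆ (x∉∁p⇒x∈p (x∈∁p⇒x∉p y∈ ∘ p⊆p∪q _))
    ... | inj₁ y∈K = y∈K
    ... | inj₂ y∈⁅a⁆ = ⊥-elim (x∈∁p⇒x∉p y∈ (q⊆p∪q _ _ y∈⁅a⁆))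

C′₂-compress : ∀ {C} → MinorClosedMatroidClass C → {ρ : SetFn (suc m)} →
               C'₂ C (suc m) ρ → 1 ≤ ρ ⁅ zero ⁆ → C'₂ C m (compress ρ zero)
C′₂-compress C-minor-closed ((isP , ρ≤2) , N , r , nat , r∈C) 1≤ρ0 =
  (compress-isPolymatroid , λ f → ≤-trans (compress≤ρ∘liftAt ⁅ f ⁆) (ρ≤2 (suc f))) ,
  N′ , r′ , natural′ , MinorClosedMatroidClass.minor-closed C-minor-closed r′ r r∈C r′-minor
  where
  open Compression isP zero 1≤ρ0
  open NaturalMatroidOfCompression isP 1≤ρ0 nat

-- Minors of a compression

module MinorOfCompression {ρ : SetFn (suc n)} (isP : IsPolymatroid ρ) (e : Fin (suc n)) (1≤ρe : 1 ≤ ρ ⁅ e ⁆)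
                          {σ : SetFn m} {X Y : Subset n} (mv : MinorVia σ (compress ρ e) X Y) where
  open IsPolymatroid isP
  open Compression isP e 1≤ρe
  open MinorVia mv

  LY = liftAt e Y

  P : Subset m → Subset (suc n)
  P Z = liftAt e (image f Z ∪ Y)

  P≡ : ∀ Z → P Z ≡ image (punchIn e ∘ f) Z ∪ LY
  P≡ Z = trans (liftAt-∪ e (image f Z) Y) (cong (_∪ LY) (sym (image-punchIn∘ e f Z)))

  minorVia-spans : Spans ρ e LY → MinorVia σ ρ (liftAt e X ∪ ⁅ e ⁆) LY
  minorVia-spans LY-spans = record
    { disjoint = disjoint′
    ; f = punchIn e ∘ f
    ; f-inj = f-inj ∘ punchIn-injective e _ _
    ; f-onto = onto
    ; rank = rank′
    }
    where
    disjoint′ : Empty ((liftAt e X ∪ ⁅ e ⁆) ∩ LY)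
    disjoint′ (y , y∈) with x∈p∩q⁻ (liftAt e X ∪ ⁅ e ⁆) LY y∈
    ... | y∈X∪e , y∈LY with x∈p∪q⁻ (liftAt e X) ⁅ e ⁆ y∈X∪e
    ... | inj₁ y∈LX = liftAt-disjoint e disjoint y∈LX y∈LY
    ... | inj₂ y∈⁅e⁆ = e∉liftAt e Y (subst (_∈ LY) (x∈⁅y⁆⇒x≡y e y∈⁅e⁆) y∈LY)

    onto : image (punchIn e ∘ f) ⊤ ≡ ∁ ((liftAt e X ∪ ⁅ e ⁆) ∪ LY)
    onto = begin
      image (punchIn e ∘ f) ⊤                ≡⟨ image-punchIn∘ e f ⊤ ⟩
      liftAt e (image f ⊤)                   ≡⟨ cong (liftAt e) f-onto ⟩
      liftAt e (∁ (X ∪ Y))                   ≡⟨ liftAt-∁ e (X ∪ Y) ⟩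
      ∁ (liftAt e (X ∪ Y) ∪ ⁅ e ⁆)           ≡⟨ cong (λ p → ∁ (p ∪ ⁅ e ⁆)) (liftAt-∪ e X Y) ⟩
      ∁ ((liftAt e X ∪ LY) ∪ ⁅ e ⁆)          ≡⟨ cong ∁ (∪-assoc (liftAt e X) LY ⁅ e ⁆) ⟩
      ∁ (liftAt e X ∪ (LY ∪ ⁅ e ⁆))          ≡⟨ cong (λ p → ∁ (liftAt e X ∪ p)) (∪-comm LY ⁅ e ⁆) ⟩
      ∁ (liftAt e X ∪ (⁅ e ⁆ ∪ LY))          ≡⟨ cong ∁ (sym (∪-assoc (liftAt e X) ⁅ e ⁆ LY)) ⟩
      ∁ ((liftAt e X ∪ ⁅ e ⁆) ∪ LY)          ∎
      where open ≡-Reasoning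

    rank′ : ∀ Z → σ Z ≡ ρ (image (punchIn e ∘ f) Z ∪ LY) ∸ ρ LY
    rank′ Z with compress-view ρ e (image f Z ∪ Y) | compress-view ρ e Y
    ... | inj₂ (¬PZ-spans , _) | _ = ⊥-elim (¬PZ-spans (Spans-mono (liftAt-⊆ e (q⊆p∪q (image f Z) Y)) LY-spans))
    ... | _ | inj₂ (¬LY-spans , _) = ⊥-elim (¬LY-spans LY-spans)
    ... | inj₁ (_ , eqZ) | inj₁ (_ , eqY) = begin
      σ Z                                             ≡⟨ rank Z ⟩
      compress ρ e (image f Z ∪ Y) ∸ compress ρ e Y    ≡⟨ cong₂ _∸_ eqZ eqY ⟩
      ρ (P Z) ∸ 1 ∸ (ρ LY ∸ 1)                        ≡⟨ [m∸1]∸[n∸1]≡m∸n _ _ (Spans⇒1≤ LY-spans) ⟩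
      ρ (P Z) ∸ ρ LY                                  ≡⟨ cong (λ p → ρ p ∸ ρ LY) (P≡ Z) ⟩
      ρ (image (punchIn e ∘ f) Z ∪ LY) ∸ ρ LY         ∎
      where open ≡-Reasoning

  g : Fin (suc m) → Fin (suc n)
  g zero = e
  g (suc i) = punchIn e (f i)

  -- (ρ \ X) / Y, with e relabelled 0
  ρ′ : SetFn (suc m)
  ρ′ W = ρ (image g W ∪ LY) ∸ ρ LY

  minorVia-ρ′ : MinorVia ρ′ ρ (liftAt e X) LY
  minorVia-ρ′ = record
    { disjoint = λ (y , y∈) → let y∈LX , y∈LY = x∈p∩q⁻ _ _ y∈ in liftAt-disjoint e disjoint y∈LX y∈LY
    ; f = g
    ; f-inj = g-injective
    ; f-onto = onto
    ; rank = λ Z → refl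
    }
    where
    g-injective : Injective _≡_ _≡_ g
    g-injective {zero} {zero} _ = refl
    g-injective {zero} {suc j} eq = ⊥-elim (punchInᵢ≢i e (f j) (sym eq))
    g-injective {suc i} {zero} eq = ⊥-elim (punchInᵢ≢i e (f i) eq)
    g-injective {suc i} {suc j} eq = cong suc (f-inj (punchIn-injective e _ _ eq))

    onto : image g ⊤ ≡ ∁ (liftAt e X ∪ LY)
    onto = begin
      image g ⊤                          ≡⟨ image-suc-inside g ⊤ ⟩
      image (punchIn e ∘ f) ⊤ ∪ ⁅ e ⁆    ≡⟨ cong (_∪ ⁅ e ⁆) (image-punchIn∘ e f ⊤) ⟩
      liftAt e (image f ⊤) ∪ ⁅ e ⁆       ≡⟨ cong (λ p → liftAt e p ∪ ⁅ e ⁆) f-onto ⟩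
      liftAt e (∁ (X ∪ Y)) ∪ ⁅ e ⁆       ≡⟨ liftAt-∁-∪⁅e⁆ e (X ∪ Y) ⟩
      ∁ (liftAt e (X ∪ Y))               ≡⟨ cong ∁ (liftAt-∪ e X Y) ⟩
      ∁ (liftAt e X ∪ LY)                ∎
      where open ≡-Reasoning

  ρ′-proper : Nonempty (X ∪ Y) → Nonempty (liftAt e X ∪ LY)
  ρ′-proper (i , i∈) = punchIn e i , subst (punchIn e i ∈_) (liftAt-∪ e X Y) (punchIn∈liftAt⁺ e i∈)

  ρ′∘liftAt : ∀ Z → ρ′ (liftAt zero Z) ≡ ρ (P Z) ∸ ρ LY
  ρ′∘liftAt Z = cong (λ p → ρ p ∸ ρ LY) (begin
    image g (outside ∷ Z) ∪ LY         ≡⟨ cong (_∪ LY) (image-suc-outside g Z) ⟩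
    image (punchIn e ∘ f) Z ∪ LY       ≡⟨ sym (P≡ Z) ⟩
    P Z                                ∎)
    where open ≡-Reasoning

  ρ′∘liftAt∪0 : ∀ Z → ρ′ (liftAt zero Z ∪ ⁅ zero ⁆) ≡ ρ (P Z ∪ ⁅ e ⁆) ∸ ρ LY
  ρ′∘liftAt∪0 Z = cong (λ p → ρ p ∸ ρ LY) (begin
    image g (inside ∷ (Z ∪ ⊥)) ∪ LY        ≡⟨ cong (λ p → image g (inside ∷ p) ∪ LY) (∪-identityʳ Z) ⟩
    image g (inside ∷ Z) ∪ LY              ≡⟨ cong (_∪ LY) (image-suc-inside g Z) ⟩
    (image (punchIn e ∘ f) Z ∪ ⁅ e ⁆) ∪ LY  ≡⟨ ∪-assoc _ ⁅ e ⁆ LY ⟩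
    image (punchIn e ∘ f) Z ∪ (⁅ e ⁆ ∪ LY)  ≡⟨ cong (image (punchIn e ∘ f) Z ∪_) (∪-comm ⁅ e ⁆ LY) ⟩
    image (punchIn e ∘ f) Z ∪ (LY ∪ ⁅ e ⁆)  ≡⟨ sym (∪-assoc _ LY ⁅ e ⁆) ⟩
    (image (punchIn e ∘ f) Z ∪ LY) ∪ ⁅ e ⁆  ≡⟨ cong (_∪ ⁅ e ⁆) (sym (P≡ Z)) ⟩
    P Z ∪ ⁅ e ⁆                            ∎)
    where open ≡-Reasoning

  1≤ρ′0 : ¬ Spans ρ e LY → 1 ≤ ρ′ ⁅ zero ⁆
  1≤ρ′0 ¬LY-spans = subst (1 ≤_) (sym ρ′0≡) (ℕₚ.m<n⇒0<n∸m (¬Spans⇒< ¬LY-spans))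
    where
    ρ′0≡ : ρ′ ⁅ zero ⁆ ≡ ρ (LY ∪ ⁅ e ⁆) ∸ ρ LY
    ρ′0≡ = cong (λ p → ρ p ∸ ρ LY) (begin
      image g (inside ∷ ⊥) ∪ LY              ≡⟨ cong (_∪ LY) (image-suc-inside g ⊥) ⟩
      (image (punchIn e ∘ f) ⊥ ∪ ⁅ e ⁆) ∪ LY  ≡⟨ cong (λ p → (p ∪ ⁅ e ⁆) ∪ LY) (image-⊥ (punchIn e ∘ f)) ⟩
      (⊥ ∪ ⁅ e ⁆) ∪ LY                        ≡⟨ cong (_∪ LY) (∪-identityˡ ⁅ e ⁆) ⟩
      ⁅ e ⁆ ∪ LY                              ≡⟨ ∪-comm ⁅ e ⁆ LY ⟩
      LY ∪ ⁅ e ⁆                              ∎)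
      where open ≡-Reasoning

  σ≗compress-ρ′ : ¬ Spans ρ e LY → ∀ Z → σ Z ≡ compress ρ′ zero Z
  σ≗compress-ρ′ ¬LY-spans Z
    with compress-view ρ e (image f Z ∪ Y) | compress-view ρ e Y | compress-view ρ′ zero Z
  ... | _ | inj₁ (LY-spans , _) | _ = ⊥-elim (¬LY-spans LY-spans)
  ... | inj₁ (_ , eqZ) | inj₂ (_ , eqY) | inj₁ (_ , eq′) = begin
    σ Z                                  ≡⟨ rank Z ⟩
    compress ρ e (image f Z ∪ Y) ∸ compress ρ e Y ≡⟨ cong₂ _∸_ eqZ eqY ⟩
    ρ (P Z) ∸ 1 ∸ ρ LY                   ≡⟨ [m∸1]∸n≡[m∸n]∸1 (ρ (P Z)) (ρ LY) ⟩
    ρ (P Z) ∸ ρ LY ∸ 1                   ≡⟨ cong (_∸ 1) (sym (ρ′∘liftAt Z)) ⟩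
    ρ′ (liftAt zero Z) ∸ 1               ≡⟨ sym eq′ ⟩
    compress ρ′ zero Z                   ∎
    where open ≡-Reasoning
  ... | inj₂ (_ , eqZ) | inj₂ (_ , eqY) | inj₂ (_ , eq′) = begin
    σ Z                                  ≡⟨ rank Z ⟩
    compress ρ e (image f Z ∪ Y) ∸ compress ρ e Y ≡⟨ cong₂ _∸_ eqZ eqY ⟩
    ρ (P Z) ∸ ρ LY                       ≡⟨ sym (ρ′∘liftAt Z) ⟩
    ρ′ (liftAt zero Z)                   ≡⟨ sym eq′ ⟩
    compress ρ′ zero Z                   ∎
    where open ≡-Reasoning
  ... | inj₁ (PZ-spans , _) | inj₂ _ | inj₂ (¬spans′ , _) =
    ⊥-elim (¬spans′ (trans (ρ′∘liftAt∪0 Z) (trans (cong (_∸ ρ LY) PZ-spans) (sym (ρ′∘liftAt Z)))))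
  ... | inj₂ (¬PZ-spans , _) | inj₂ _ | inj₁ (spans′ , _) =
    ⊥-elim (¬PZ-spans (ℕₚ.∸-cancelʳ-≡ (mono (λ x∈ → p⊆p∪q ⁅ e ⁆ (LY⊆P x∈))) (mono LY⊆P)
      (trans (sym (ρ′∘liftAt∪0 Z)) (trans spans′ (ρ′∘liftAt Z)))))
    where
    LY⊆P : LY ⊆ P Z
    LY⊆P = liftAt-⊆ e (q⊆p∪q (image f Z) Y)

IsNaturalMatroid-resp-≗ : ∀ {σ τ : SetFn n} {r : SetFn N} → (∀ Z → σ Z ≡ τ Z) →
                          IsNaturalMatroid τ r → IsNaturalMatroid σ r
IsNaturalMatroid-resp-≗ {r = r} σ≗τ nat = record
  { π = π
  ; fibre-size = λ f → trans (fibre-size f) (sym (σ≗τ ⁅ f ⁆))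
  ; rank-lower = λ X A → subst (λ v → r X ≤ v + ∣ X ─ preimage π A ∣) (sym (σ≗τ A)) (rank-lower X A)
  ; rank-attained = λ X → let A , eq = rank-attained X in
                          A , trans eq (cong (_+ ∣ X ─ preimage π A ∣) (sym (σ≗τ A)))
  }
  where open IsNaturalMatroid nat

C′₂-resp-≗ : ∀ {C} {σ τ : SetFn n} → (∀ Z → σ Z ≡ τ Z) → C'₂ C n τ → C'₂ C n σ
C′₂-resp-≗ σ≗τ ((isP , τ≤2) , N , r , nat , r∈C) =
  (IsPolymatroid-resp-≗ σ≗τ isP , λ f → subst (_≤ 2) (sym (σ≗τ ⁅ f ⁆)) (τ≤2 f)) ,
  N , r , IsNaturalMatroid-resp-≗ σ≗τ nat , r∈C

module _ {C} (C-minor-closed : MinorClosedMatroidClass C) {ρ : SetFn (suc n)} (em : ExcludedMinor (C'₂ C) ρ)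
         (e : Fin (suc n)) (1≤ρe : 1 ≤ ρ ⁅ e ⁆) where
  open ExcludedMinor em

  proper-minors-of-compression : ∀ {m} (σ : SetFn m) → IsProperMinor σ (compress ρ e) → C'₂ C m σ
  proper-minors-of-compression {m} σ (X , Y , mv , X∪Y≢∅) = by-cases (ρ (liftAt e Y ∪ ⁅ e ⁆) ℕₚ.≟ ρ (liftAt e Y))
    where
    open MinorOfCompression polymatroid e 1≤ρe mv
    by-cases : Dec (Spans ρ e (liftAt e Y)) → C'₂ C m σ
    by-cases (yes LY-spans) = proper-minors-in σ
      (liftAt e X ∪ ⁅ e ⁆ , liftAt e Y , minorVia-spans LY-spans , e , p⊆p∪q _ (q⊆p∪q _ _ (x∈⁅x⁆ e)))
    by-cases (no ¬LY-spans) = C′₂-resp-≗ (σ≗compress-ρ′ ¬LY-spans) (C′₂-compress C-minor-closed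
      (proper-minors-in ρ′ (liftAt e X , liftAt e Y , minorVia-ρ′ , ρ′-proper X∪Y≢∅)) (1≤ρ′0 ¬LY-spans))

lemma5p6 : (C : Class) → MinorClosedMatroidClass C →
           {n : ℕ} (ρ : SetFn (suc n)) → ExcludedMinor (C'₂ C) ρ →
           (e : Fin (suc n)) → ρ ⁅ e ⁆ ≡ 2 →
           ExcludedMinor (C'₂ C) (compress ρ e) ⇔ (¬ C'₂ C n (compress ρ e))
lemma5p6 C C-minor-closed ρ em e ρe≡2 = mk⇔ ExcludedMinor.not-in-class λ compress∉C′₂ → record
  { polymatroid = Compression.compress-isPolymatroid (ExcludedMinor.polymatroid em) e 1≤ρe
  ; not-in-class = compress∉C′₂
  ; proper-minors-in = proper-minors-of-compression C-minor-closed em e 1≤ρe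
  }
  where
  1≤ρe : 1 ≤ ρ ⁅ e ⁆
  1≤ρe = subst (1 ≤_) (sym ρe≡2) (s≤s z≤n)
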